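{- Let $w_1,\ldots,w_s$ be positive integers, let $G$ be the weighted line graph they define, and let $M_0,M_1,M_2,\ldots$ be a sequence of matchings produced by the Hungarian Algorithm on $G$. Let $r\le\lceil s/2\rceil$ and define $\Delta_i=\mathrm{wt}(M_i)-\mathrm{wt}(M_{i-1})$ for $1\le i\le r$. Then $\Delta_1\le\Delta_2\le\cdots\le\Delta_r$.
   Context: The line graph $G$ has vertices $v_0,\ldots,v_s$ and edges $E=\{e_1,\ldots,e_s\}$ with $e_i=(v_{i-1},v_i)$ and weight $\mathrm{wt}(e_i)=w_i$. A matching is a subset $M\subseteq E$ with $|M\cap\{e_i,e_{i+1}\}|\le 1$ for each $i$; $\mathrm{wt}(M)=\sum_{e_i\in M}\mathrm{wt}(e_i)$. A chain in a matching $M$ is a set $C=\{e_i,e_{i+2},\ldots,e_{i+2c}\}\subseteq M$ for some $c\in\mathbb{N}$; it is maximal if $e_{i-2},e_{i+2c+2}\notin M$. Its augmentation is $\mathrm{Aug}(C)=\{e_{i-1},e_{i+1},\ldots,e_{i+2c+1}\}\cap E$. For $i\in[s]$, $M$ contains the $i$-th empty chain $\emptyset_i$ if $M$ contains none of $e_{i-1},e_i,e_{i+1}$; empty chains are considered maximal, are treated as the empty set, and $\mathrm{Aug}(\emptyset_i)=\{e_i\}$. A matching $M'$ is an augmentation of $M$ if $M'=(M\setminus C)\cup\mathrm{Aug}(C)$ for some maximal (possibly empty) chain $C$ of $M$ and $|M'|=|M|+1$. The Hungarian Algorithm sets $M_0=\emptyset$ and, for each $i\ge1$, lets $M_i$ be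 any augmentation of $M_{i-1}$ of minimum weight among all augmentations of $M_{i-1}$. -}

module Defs where

open import Data.Nat using (ℕ; zero; suc; _+_; _*_; _≤_; _<_)
open import Data.Bool using (Bool; true; false; if_then_else_)
open import Data.Integer as ℤ using (ℤ; +_)
open import Data.Product using (Σ; _×_; ∃-syntax)
open import Data.Sum using (_⊎_)
open import Relation.Nullary using (¬_)
open import Relation.Binary.PropositionalEquality using (_≡_)
open import Function.Bundles using (_⇔_)

-- Edges of the line graph on v_0,...,v_s are e_1,...,e_s, identified with
-- their indices j ∈ {1,...,s}.  A set of edges is a Boolean predicate on ℕ.
EdgeSet : Set
EdgeSet = ℕ → Bool

InE : ℕ → ℕ → Set
InE s j = 1 ≤ j × j ≤ s

SubsetE : ℕ → EdgeSet → Set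
SubsetE s M = ∀ j → M j ≡ true → InE s j

IsMatching : ℕ → EdgeSet → Set
IsMatching s M = SubsetE s M × (∀ i → ¬ (M i ≡ true × M (suc i) ≡ true))

sumTo : (ℕ → ℕ) → ℕ → ℕ
sumTo f zero = 0
sumTo f (suc n) = sumTo f n + f (suc n)

card : ℕ → EdgeSet → ℕ
card s M = sumTo (λ j → if M j then 1 else 0) s

wt : ℕ → (ℕ → ℕ) → EdgeSet → ℕ
wt s w M = sumTo (λ j → if M j then w j else 0) s

InChain : ℕ → ℕ → ℕ → Set
InChain i c j = ∃[ k ] (k ≤ c × j ≡ i + 2 * k)

-- j ∈ Aug(C) = {e_{i-1}, e_{i+1}, ..., e_{i+2c+1}} ∩ E
InAug : ℕ → ℕ → ℕ → ℕ → Set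
InAug s i c j = (∃[ k ] (k ≤ suc c × j + 1 ≡ i + 2 * k)) × InE s j

IsMaximalChain : EdgeSet → ℕ → ℕ → Set
IsMaximalChain M i c =
  (∀ j → InChain i c j → M j ≡ true) ×
  (∀ j → j + 2 ≡ i → M j ≡ false) ×
  M (i + 2 * c + 2) ≡ false

HasEmptyChain : ℕ → EdgeSet → ℕ → Set
HasEmptyChain s M i =
  InE s i × (∀ j → j + 1 ≡ i → M j ≡ false) × M i ≡ false × M (suc i) ≡ false

IsAugmentation : ℕ → EdgeSet → EdgeSet → Set
IsAugmentation s M M' =
  IsMatching s M' × card s M' ≡ suc (card s M) ×
  ( (Σ ℕ λ i → Σ ℕ λ c → IsMaximalChain M i c ×
       (∀ j → (M' j ≡ true) ⇔ ((M j ≡ true × ¬ InChain i c j) ⊎ InAug s i c j)))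
  ⊎ (Σ ℕ λ i → HasEmptyChain s M i ×
       (∀ j → (M' j ≡ true) ⇔ (M j ≡ true ⊎ j ≡ i))) )

IsHungarianRun : ℕ → (ℕ → ℕ) → (ℕ → EdgeSet) → ℕ → Set
IsHungarianRun s w Ms r =
  (∀ j → Ms 0 j ≡ false) ×
  (∀ i → 1 ≤ i → i ≤ r →
     Σ ℕ λ p → suc p ≡ i ×
       IsAugmentation s (Ms p) (Ms i) ×
       (∀ M' → IsAugmentation s (Ms p) M' → wt s w (Ms i) ≤ wt s w M'))

Δ : ℕ → (ℕ → ℕ) → (ℕ → EdgeSet) → ℕ → ℤ
Δ s w Ms zero = + 0
Δ s w Ms (suc p) = (+ wt s w (Ms (suc p))) ℤ.- (+ wt s w (Ms p))

-- Augmenting a maximal chain of a matching M on the path flips an interval [p, q] of even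
-- width on which M alternates absent, present, …, absent; conversely such a flip whose end
-- vertices are free in M is an augmentation (counting edges forces the interval into E).
-- Let B be a cheapest augmentation of A, flipping I₁, and C an augmentation of B, flipping I₂.
-- Then I₂ either misses I₁ or strictly contains it, and in both cases the edges of C and A
-- redistribute into two augmentations X, Y of A (X = B and Y = A flipped on I₂, respectively
-- A flipped on the two components of I₂ ∖ I₁). Hence wt C + wt A = wt X + wt Y ≥ 2 wt B,
-- which is Δ_{i+1} ≤ Δ_{i+2}.

module Submission where

open import Defs
open import Data.Nat using (ℕ; suc; _≤_; _<_; ⌈_/2⌉)
open import Data.Integer as ℤ using (ℤ; +≤+) renaming (_≤_ to _≤ℤ_)

open import Data.Nat using (zero; _+_; _*_; _∸_; z≤n; s≤s; _<?_; _≤?_)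
open import Data.Nat.Properties
open import Data.Bool using (Bool; true; false; not; _xor_; if_then_else_)
open import Data.Bool.Properties using (not-involutive; not-injective; not-distribˡ-xor; xor-same; xor-identityʳ)
open import Data.Product using (Σ; _×_; _,_; proj₁; proj₂; ∃-syntax)
open import Data.Sum using (_⊎_; inj₁; inj₂; [_,_]′)
open import Data.Empty using (⊥; ⊥-elim)
open import Relation.Nullary using (¬_; yes; no)
open import Relation.Binary.PropositionalEquality
open import Function.Bundles using (_⇔_; Equivalence; mk⇔)
open import Function.Base using (_∘_)
open import Data.Nat.Tactic.RingSolver using (solve-∀)
import Data.Integer.Properties as ℤₚ
import Data.Integer.Tactic.RingSolver as ℤ-Solver

odd : ℕ → Bool
odd zero = false
odd (suc n) = not (odd n)

odd-+ : ∀ m n → odd (m + n) ≡ odd m xor odd n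
odd-+ zero n = refl
odd-+ (suc m) n = trans (cong not (odd-+ m n)) (not-distribˡ-xor (odd m) (odd n))

odd-2* : ∀ k → odd (2 * k) ≡ false
odd-2* k rewrite odd-+ k (k + 0) | +-identityʳ k = xor-same (odd k)

odd-1+2* : ∀ k → odd (suc (2 * k)) ≡ true
odd-1+2* k = cong not (odd-2* k)

even-or-odd : ∀ n → (∃[ k ] n ≡ 2 * k) ⊎ (∃[ k ] n ≡ suc (2 * k))
even-or-odd zero = inj₁ (0 , refl)
even-or-odd (suc n) with even-or-odd n
... | inj₁ (k , refl) = inj₂ (k , refl)
... | inj₂ (k , refl) = inj₁ (suc k , cong suc (sym (+-suc k (k + 0))))

odd-suc-∸ : ∀ {p j} → p ≤ j → odd (suc j ∸ p) ≡ not (odd (j ∸ p))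
odd-suc-∸ {p} {j} p≤j = cong odd (+-∸-assoc 1 p≤j)

odd-∸-rebase : ∀ {z y x} → z ≤ y → y ≤ x → odd (y ∸ z) ≡ false → odd (x ∸ z) ≡ odd (x ∸ y)
odd-∸-rebase {z} {y} {x} z≤y y≤x even = begin
  odd (x ∸ z)                 ≡⟨ cong odd (sym ∸-split) ⟩
  odd ((x ∸ y) + (y ∸ z))     ≡⟨ odd-+ (x ∸ y) (y ∸ z) ⟩
  odd (x ∸ y) xor odd (y ∸ z) ≡⟨ cong (odd (x ∸ y) xor_) even ⟩
  odd (x ∸ y) xor false       ≡⟨ xor-identityʳ (odd (x ∸ y)) ⟩
  odd (x ∸ y)                 ∎
  where
  open ≡-Reasoning
  ∸-split : (x ∸ y) + (y ∸ z) ≡ x ∸ z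
  ∸-split = trans (sym (+-∸-assoc (x ∸ y) z≤y)) (cong (_∸ z) (m∸n+n≡m y≤x))

≡-from-true-⇔ : ∀ {a b : Bool} → (a ≡ true → b ≡ true) → (b ≡ true → a ≡ true) → a ≡ b
≡-from-true-⇔ {true}  {true}  _ _ = refl
≡-from-true-⇔ {true}  {false} f _ = sym (f refl)
≡-from-true-⇔ {false} {true}  _ g = g refl
≡-from-true-⇔ {false} {false} _ _ = refl

false≢true : false ≢ true
false≢true ()

IsMatching⇒next-false : ∀ {s M a} → IsMatching s M → M a ≡ true → M (suc a) ≡ false
IsMatching⇒next-false {M = M} {a} (_ , free) Ma with M (suc a) in eq
... | true  = ⊥-elim (free a (Ma , eq))
... | false = refl

IsMatching⇒prev-false : ∀ {s M a} → IsMatching s M → M (suc a) ≡ true → M a ≡ false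
IsMatching⇒prev-false {M = M} {a} (_ , free) Msa with M a in eq
... | true  = ⊥-elim (free a (eq , Msa))
... | false = refl

Inside : ℕ → ℕ → ℕ → Set
Inside p q j = p ≤ j × j ≤ q

Outside : ℕ → ℕ → ℕ → Set
Outside p q j = j < p ⊎ q < j

outside-or-inside : ∀ p q j → Outside p q j ⊎ Inside p q j
outside-or-inside p q j with j <? p | q <? j
... | yes j<p | _       = inj₁ (inj₁ j<p)
... | no _    | yes q<j = inj₁ (inj₂ q<j)
... | no j≮p  | no q≮j  = inj₂ (≮⇒≥ j≮p , ≮⇒≥ q≮j)

Outside⇒¬Inside : ∀ {p q j} → Outside p q j → ¬ Inside p q j
Outside⇒¬Inside (inj₁ j<p) (p≤j , _) = <⇒≱ j<p p≤j
Outside⇒¬Inside (inj₂ q<j) (_ , j≤q) = <⇒≱ q<j j≤q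

Inside⇒InE : ∀ {s p q j} → 1 ≤ p → q ≤ s → Inside p q j → InE s j
Inside⇒InE 1≤p q≤s (p≤j , j≤q) = ≤-trans 1≤p p≤j , ≤-trans j≤q q≤s

-- Outside E the target need not follow the pattern: an augmentation of a chain
-- touching e₁ or e_s drops the edge that would fall off the graph.
record Flip (s : ℕ) (M M' : EdgeSet) (p q : ℕ) : Set where
  field
    p≤q        : p ≤ q
    even-width : odd (q ∸ p) ≡ false
    outside    : ∀ j → Outside p q j → M' j ≡ M j
    before     : ∀ j → Inside p q j → M j ≡ odd (j ∸ p)
    after      : ∀ j → Inside p q j → InE s j → M' j ≡ not (odd (j ∸ p))

  before-p : M p ≡ false
  before-p = trans (before p (≤-refl , p≤q)) (cong odd (n∸n≡0 p))

  before-q : M q ≡ false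
  before-q = trans (before q (p≤q , ≤-refl)) even-width

record IntervalFlip (s : ℕ) (M M' : EdgeSet) : Set where
  field
    {p q} : ℕ
    flip  : Flip s M M' p q
    1≤p   : 1 ≤ p
    q≤s   : q ≤ s

  open Flip flip public

  after-E : ∀ j → Inside p q j → M' j ≡ not (odd (j ∸ p))
  after-E j j∈ = after j j∈ (Inside⇒InE 1≤p q≤s j∈)

  after-p : M' p ≡ true
  after-p = trans (after-E p (≤-refl , p≤q)) (cong (not ∘ odd) (n∸n≡0 p))

  after-q : M' q ≡ true
  after-q = trans (after-E q (p≤q , ≤-refl)) (cong not even-width)

  before-pred-p : IsMatching s M' → ∀ j → suc j ≡ p → M j ≡ false
  before-pred-p mM' j 1+j≡p = trans (sym (outside j (inj₁ (≤-reflexive 1+j≡p))))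
                                    (IsMatching⇒prev-false mM' (subst (λ i → M' i ≡ true) (sym 1+j≡p) after-p))

  before-suc-q : IsMatching s M' → M (suc q) ≡ false
  before-suc-q mM' = trans (sym (outside (suc q) (inj₂ ≤-refl))) (IsMatching⇒next-false mM' after-q)

  after-false⇒next-true : ∀ {j} → Inside p q j → M' j ≡ false → Inside p q (suc j) × M' (suc j) ≡ true
  after-false⇒next-true {j} (p≤j , j≤q) M'j = (≤-trans p≤j (n≤1+n j) , j<q) , M'-1+j
    where
    odd-j : odd (j ∸ p) ≡ true
    odd-j = not-injective (trans (sym (after-E j (p≤j , j≤q))) M'j)
    j≢q : j ≢ q
    j≢q j≡q = false≢true (trans (sym even-width) (trans (cong (λ i → odd (i ∸ p)) (sym j≡q)) odd-j))
    j<q : j < q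
    j<q = ≤∧≢⇒< j≤q j≢q
    M'-1+j : M' (suc j) ≡ true
    M'-1+j = trans (after-E (suc j) (≤-trans p≤j (n≤1+n j) , j<q))
                   (trans (cong not (odd-suc-∸ p≤j)) (trans (not-involutive _) odd-j))

  after-false⇒prev-true : ∀ {j} → Inside p q (suc j) → M' (suc j) ≡ false → Inside p q j × M' j ≡ true
  after-false⇒prev-true {j} (p≤1+j , 1+j≤q) M'-1+j = (p≤j , ≤-trans (n≤1+n j) 1+j≤q) , M'j
    where
    odd-1+j : odd (suc j ∸ p) ≡ true
    odd-1+j = not-injective (trans (sym (after-E (suc j) (p≤1+j , 1+j≤q))) M'-1+j)
    p≢1+j : p ≢ suc j
    p≢1+j p≡1+j = false≢true (trans (cong odd (sym (n∸n≡0 p))) (trans (cong (λ i → odd (i ∸ p)) p≡1+j) odd-1+j))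
    p≤j : p ≤ j
    p≤j = ≤-pred (≤∧≢⇒< p≤1+j p≢1+j)
    M'j : M' j ≡ true
    M'j = trans (after-E j (p≤j , ≤-trans (n≤1+n j) 1+j≤q))
                (trans (sym (odd-suc-∸ p≤j)) odd-1+j)

  pattern-from : ∀ {a j} → p ≤ a → odd (a ∸ p) ≡ false → a ≤ j → j ≤ q →
                 M j ≡ odd (j ∸ a) × M' j ≡ not (odd (j ∸ a))
  pattern-from {a} {j} p≤a even-a a≤j j≤q =
    trans (before j j∈) rebase , trans (after-E j j∈) (cong not rebase)
    where
    j∈ : Inside p q j
    j∈ = ≤-trans p≤a a≤j , j≤q
    rebase : odd (j ∸ p) ≡ odd (j ∸ a)
    rebase = odd-∸-rebase p≤a a≤j even-a

  isMatching : IsMatching s M → (∀ j → suc j ≡ p → M j ≡ false) → M (suc q) ≡ false → IsMatching s M'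
  isMatching (M⊆E , M-free) left-free right-free = M'⊆E , M'-free
    where
    M'⊆E : SubsetE s M'
    M'⊆E j M'j with outside-or-inside p q j
    ... | inj₁ o  = M⊆E j (trans (sym (outside j o)) M'j)
    ... | inj₂ j∈ = Inside⇒InE 1≤p q≤s j∈
    M'-free : ∀ i → ¬ (M' i ≡ true × M' (suc i) ≡ true)
    M'-free i (M'i , M'-1+i) with outside-or-inside p q i | outside-or-inside p q (suc i)
    ... | inj₁ o | inj₁ o′ = M-free i (trans (sym (outside i o)) M'i , trans (sym (outside (suc i) o′)) M'-1+i)
    ... | inj₂ i∈ | inj₂ 1+i∈ = false≢true (trans (sym (cong not odd-i)) (trans (sym (after-E i i∈)) M'i))
      where
      odd-i : odd (i ∸ p) ≡ true
      odd-i = trans (sym (not-involutive _))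
                    (trans (cong not (sym (odd-suc-∸ (proj₁ i∈)))) (trans (sym (after-E (suc i) 1+i∈)) M'-1+i))
    ... | inj₁ (inj₁ i<p) | inj₂ (p≤1+i , _) =
      false≢true (trans (sym (left-free i (≤-antisym i<p p≤1+i))) (trans (sym (outside i (inj₁ i<p))) M'i))
    ... | inj₁ (inj₂ q<i) | inj₂ (_ , 1+i≤q) = <-asym q<i 1+i≤q
    ... | inj₂ (p≤i , _) | inj₁ (inj₁ 1+i<p) = <-asym 1+i<p (s≤s p≤i)
    ... | inj₂ (_ , i≤q) | inj₁ (inj₂ q<1+i) =
      false≢true (trans (sym (subst (λ k → M (suc k) ≡ false) (≤-antisym (≤-pred q<1+i) i≤q) right-free))
                        (trans (sym (outside (suc i) (inj₂ q<1+i))) M'-1+i))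

ind : Bool → ℕ
ind b = if b then 1 else 0

ind≤1 : ∀ b → ind b ≤ 1
ind≤1 true  = ≤-refl
ind≤1 false = z≤n

sumTo-telescope : ∀ (f g φ : ℕ → ℕ) n → (∀ j → j < n → f (suc j) + φ j ≡ g (suc j) + φ (suc j)) →
                  sumTo f n + φ 0 ≡ sumTo g n + φ n
sumTo-telescope f g φ zero     _    = refl
sumTo-telescope f g φ (suc n) step = begin
  sumTo f n + f (suc n) + φ 0       ≡⟨ swap (sumTo f n) (f (suc n)) (φ 0) ⟩
  sumTo f n + φ 0 + f (suc n)       ≡⟨ cong (_+ f (suc n)) (sumTo-telescope f g φ n (λ j j<n → step j (m<n⇒m<1+n j<n))) ⟩
  sumTo g n + φ n + f (suc n)       ≡⟨ +-assoc (sumTo g n) (φ n) (f (suc n)) ⟩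
  sumTo g n + (φ n + f (suc n))     ≡⟨ cong (sumTo g n +_) (trans (+-comm (φ n) (f (suc n))) (step n ≤-refl)) ⟩
  sumTo g n + (g (suc n) + φ (suc n)) ≡⟨ sym (+-assoc (sumTo g n) (g (suc n)) (φ (suc n))) ⟩
  sumTo g n + g (suc n) + φ (suc n) ∎
  where
  open ≡-Reasoning
  swap : ∀ a b c → a + b + c ≡ a + c + b
  swap = solve-∀

-- card j M' − card j M = potential j − potential 0 for all j ≤ s.
module FlipCount {s : ℕ} {M M' : EdgeSet} {p q : ℕ} (F : Flip s M M' p q) where
  open Flip F

  potential : ℕ → ℕ
  potential j with outside-or-inside p q j
  ... | inj₁ (inj₁ _) = 0
  ... | inj₁ (inj₂ _) = 1
  ... | inj₂ _        = ind (not (odd (j ∸ p)))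

  potential-below : ∀ {j} → j < p → potential j ≡ 0
  potential-below {j} j<p with outside-or-inside p q j
  ... | inj₁ (inj₁ _)   = refl
  ... | inj₁ (inj₂ q<j) = ⊥-elim (<-asym j<p (≤-<-trans p≤q q<j))
  ... | inj₂ j∈         = ⊥-elim (Outside⇒¬Inside (inj₁ j<p) j∈)

  potential-inside : ∀ {j} → Inside p q j → potential j ≡ ind (not (odd (j ∸ p)))
  potential-inside {j} j∈ with outside-or-inside p q j
  ... | inj₁ o = ⊥-elim (Outside⇒¬Inside o j∈)
  ... | inj₂ _ = refl

  potential-from-q : ∀ {j} → q ≤ j → potential j ≡ 1
  potential-from-q {j} q≤j with outside-or-inside p q j
  ... | inj₁ (inj₁ j<p) = ⊥-elim (<⇒≱ j<p (≤-trans p≤q q≤j))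
  ... | inj₁ (inj₂ _)   = refl
  ... | inj₂ (_ , j≤q) rewrite ≤-antisym j≤q q≤j = cong (ind ∘ not) even-width

  potential≤1 : ∀ j → potential j ≤ 1
  potential≤1 j with outside-or-inside p q j
  ... | inj₁ (inj₁ _) = z≤n
  ... | inj₁ (inj₂ _) = ≤-refl
  ... | inj₂ _        = ind≤1 _

  potential-pred : ∀ {j} → Inside p q (suc j) → potential j ≡ ind (odd (suc j ∸ p))
  potential-pred {j} (p≤1+j , 1+j≤q) with m≤n⇒m<n∨m≡n p≤1+j
  ... | inj₂ refl = trans (potential-below ≤-refl) (cong (ind ∘ odd) (sym (n∸n≡0 (suc j))))
  ... | inj₁ p<1+j = begin
    potential j                   ≡⟨ potential-inside (≤-pred p<1+j , ≤-trans (n≤1+n j) 1+j≤q) ⟩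
    ind (not (odd (j ∸ p)))       ≡⟨ cong ind (sym (odd-suc-∸ (≤-pred p<1+j))) ⟩
    ind (odd (suc j ∸ p))         ∎
    where open ≡-Reasoning

  potential-step : ∀ j → j < s → ind (M' (suc j)) + potential j ≡ ind (M (suc j)) + potential (suc j)
  potential-step j j<s with outside-or-inside p q (suc j)
  ... | inj₁ (inj₁ 1+j<p)
    rewrite outside (suc j) (inj₁ 1+j<p) | potential-below (<-trans (n<1+n j) 1+j<p) = refl
  ... | inj₁ (inj₂ q<1+j)
    rewrite outside (suc j) (inj₂ q<1+j) | potential-from-q (≤-pred q<1+j) = refl
  ... | inj₂ 1+j∈
    rewrite after (suc j) 1+j∈ (s≤s z≤n , j<s) | before (suc j) 1+j∈
          | potential-pred 1+j∈ = +-comm (ind (not (odd (suc j ∸ p)))) _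

  card-flip : card s M' + potential 0 ≡ card s M + potential s
  card-flip = sumTo-telescope _ _ potential s potential-step

  card-suc : 1 ≤ p → q ≤ s → card s M' ≡ suc (card s M)
  card-suc 1≤p q≤s = begin
    card s M'                 ≡⟨ sym (+-identityʳ _) ⟩
    card s M' + 0             ≡⟨ cong (card s M' +_) (sym (potential-below 1≤p)) ⟩
    card s M' + potential 0   ≡⟨ card-flip ⟩
    card s M + potential s    ≡⟨ cong (card s M +_) (potential-from-q q≤s) ⟩
    card s M + 1              ≡⟨ +-comm (card s M) 1 ⟩
    suc (card s M)            ∎
    where open ≡-Reasoning

  card-suc⇒bounds : SubsetE s M → card s M' ≡ suc (card s M) → 1 ≤ p × q ≤ s
  card-suc⇒bounds M⊆E card-M' = 1≤p , q≤s
    where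
    jump : suc (potential 0) ≡ potential s
    jump = +-cancelˡ-≡ (card s M) _ _ (begin
      card s M + suc (potential 0)  ≡⟨ +-suc (card s M) (potential 0) ⟩
      suc (card s M) + potential 0  ≡⟨ cong (_+ potential 0) (sym card-M') ⟩
      card s M' + potential 0       ≡⟨ card-flip ⟩
      card s M + potential s        ∎)
      where open ≡-Reasoning
    potential-0 : potential 0 ≡ 0
    potential-0 = n≤0⇒n≡0 (≤-pred (subst (_≤ 1) (sym jump) (potential≤1 s)))
    potential-s : potential s ≡ 1
    potential-s = trans (sym jump) (cong suc potential-0)
    1≤p : 1 ≤ p
    1≤p = n≢0⇒n>0 λ p≡0 → 0≢1+n (begin
      0                          ≡⟨ sym potential-0 ⟩
      potential 0                ≡⟨ potential-inside (subst (_≤ 0) (sym p≡0) z≤n , z≤n) ⟩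
      ind (not (odd (0 ∸ p)))    ≡⟨ cong (ind ∘ not ∘ odd) (0∸n≡0 p) ⟩
      1                          ∎)
      where open ≡-Reasoning
    q≤s : q ≤ s
    q≤s with q ≤? s
    ... | yes q≤s = q≤s
    ... | no q≰s with s <? p
    ...   | yes s<p = ⊥-elim (0≢1+n (trans (sym (potential-below s<p)) potential-s))
    ...   | no s≮p = ⊥-elim (n≮n s (proj₂ (M⊆E (suc s) M-1+s)))
      where
      s∈ : Inside p q s
      s∈ = ≮⇒≥ s≮p , <⇒≤ (≰⇒> q≰s)
      even-s : odd (s ∸ p) ≡ false
      even-s with odd (s ∸ p) | trans (sym (potential-inside s∈)) potential-s
      ... | false | _ = refl
      M-1+s : M (suc s) ≡ true
      M-1+s = trans (before (suc s) (≤-trans (proj₁ s∈) (n≤1+n s) , ≰⇒> q≰s))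
                    (trans (odd-suc-∸ (proj₁ s∈)) (cong not even-s))

inside-offset : ∀ p {m d} → d ≤ m → Inside p (p + m) (p + d)
inside-offset p d≤m = m≤m+n p _ , +-monoʳ-≤ p d≤m

offset-of-inside : ∀ {p m j} → Inside p (p + m) j → j ≡ p + (j ∸ p) × j ∸ p ≤ m
offset-of-inside {p} {m} (p≤j , j≤p+m) =
  sym (m+[n∸m]≡n p≤j) , subst (_ ≤_) (m+n∸m≡n p m) (∸-monoˡ-≤ p j≤p+m)

1+2*-≤-2*suc : ∀ {k c} → k ≤ c → suc (2 * k) ≤ 2 * suc c
1+2*-≤-2*suc {k} {c} k≤c = subst (suc (2 * k) ≤_) (sym (*-suc 2 c)) (m≤n⇒m≤1+n (s≤s (*-monoʳ-≤ 2 k≤c)))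

1+2*-≤-2*suc⁻¹ : ∀ {k c} → suc (2 * k) ≤ 2 * suc c → k ≤ c
1+2*-≤-2*suc⁻¹ {k} {c} 1+2k≤ = ≮⇒≥ λ c<k → n≮n (2 * k) (≤-trans 1+2k≤ (*-monoʳ-≤ 2 c<k))

-- A chain {e_{p+1}, e_{p+3}, …, e_{p+2c+1}} sits at the odd offsets of [p, p + 2(c+1)],
-- its augmentation at the even ones.
module ChainOffsets {p c : ℕ} where

  InChain⇒odd-offset : ∀ {j} → InChain (suc p) c j → Inside p (p + 2 * suc c) j × odd (j ∸ p) ≡ true
  InChain⇒odd-offset (k , k≤c , refl) rewrite sym (+-suc p (2 * k)) =
    inside-offset p (1+2*-≤-2*suc k≤c) , trans (cong odd (m+n∸m≡n p _)) (odd-1+2* k)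

  odd-offset⇒InChain : ∀ {j} → Inside p (p + 2 * suc c) j → odd (j ∸ p) ≡ true → InChain (suc p) c j
  odd-offset⇒InChain {j} j∈ odd-j with offset-of-inside j∈ | even-or-odd (j ∸ p)
  ... | _ , _ | inj₁ (k , d≡) = ⊥-elim (false≢true (trans (sym (odd-2* k)) (trans (cong odd (sym d≡)) odd-j)))
  ... | j≡ , d≤ | inj₂ (k , d≡) =
    k , 1+2*-≤-2*suc⁻¹ (subst (_≤ 2 * suc c) d≡ d≤) , trans j≡ (trans (cong (p +_) d≡) (+-suc p (2 * k)))

  augOffset⇒even-offset : ∀ {j} → (∃[ k ] (k ≤ suc c × j + 1 ≡ suc p + 2 * k)) →
                          Inside p (p + 2 * suc c) j × odd (j ∸ p) ≡ false
  augOffset⇒even-offset {j} (k , k≤ , j+1≡) rewrite suc-injective (trans (+-comm 1 j) j+1≡) =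
    inside-offset p (*-monoʳ-≤ 2 k≤) , trans (cong odd (m+n∸m≡n p _)) (odd-2* k)

  even-offset⇒augOffset : ∀ {j} → Inside p (p + 2 * suc c) j → odd (j ∸ p) ≡ false →
                          ∃[ k ] (k ≤ suc c × j + 1 ≡ suc p + 2 * k)
  even-offset⇒augOffset {j} j∈ even-j with offset-of-inside j∈ | even-or-odd (j ∸ p)
  ... | j≡ , d≤ | inj₁ (k , d≡) =
    k , *-cancelˡ-≤ 2 (subst (_≤ 2 * suc c) d≡ d≤) , trans (+-comm j 1) (cong suc (trans j≡ (cong (p +_) d≡)))
  ... | _ , _ | inj₂ (k , d≡) = ⊥-elim (false≢true (trans (sym even-j) (trans (cong odd d≡) (odd-1+2* k))))

module FlipAugmentation {s : ℕ} {M M' : EdgeSet} (mM' : IsMatching s M') (F : IntervalFlip s M M') where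
  open IntervalFlip F
  open ChainOffsets

  emptyChain : q ≡ p → HasEmptyChain s M p × (∀ j → (M' j ≡ true) ⇔ (M j ≡ true ⊎ j ≡ p))
  emptyChain q≡p =
    (Inside⇒InE 1≤p q≤s (≤-refl , p≤q) , (λ j j+1≡p → before-pred-p mM' j (trans (+-comm 1 j) j+1≡p)) ,
     before-p , subst (λ i → M (suc i) ≡ false) q≡p (before-suc-q mM')) ,
    iff
    where
    iff : ∀ j → (M' j ≡ true) ⇔ (M j ≡ true ⊎ j ≡ p)
    iff j with outside-or-inside p q j
    ... | inj₁ o = mk⇔ (λ M'j → inj₁ (trans (sym (outside j o)) M'j)) from
      where
      from : M j ≡ true ⊎ j ≡ p → M' j ≡ true
      from (inj₁ Mj)   = trans (outside j o) Mj
      from (inj₂ refl) = ⊥-elim (Outside⇒¬Inside o (≤-refl , p≤q))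
    ... | inj₂ (p≤j , j≤q) with ≤-antisym (subst (j ≤_) q≡p j≤q) p≤j
    ...   | refl = mk⇔ (λ _ → inj₂ refl) (λ _ → after-p)

  chain : ∀ c → q ≡ p + 2 * suc c →
          IsMaximalChain M (suc p) c ×
          (∀ j → (M' j ≡ true) ⇔ ((M j ≡ true × ¬ InChain (suc p) c j) ⊎ InAug s (suc p) c j))
  chain c q≡ = (chain⊆M , left-free , right-free) , iff
    where
    widen : ∀ {j} → Inside p (p + 2 * suc c) j → Inside p q j
    widen = subst (λ r → Inside p r _) (sym q≡)
    narrow : ∀ {j} → Inside p q j → Inside p (p + 2 * suc c) j
    narrow = subst (λ r → Inside p r _) q≡
    chain⊆M : ∀ j → InChain (suc p) c j → M j ≡ true
    chain⊆M j j∈C with InChain⇒odd-offset j∈C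
    ... | j∈ , odd-j = trans (before j (widen j∈)) odd-j
    left-free : ∀ j → j + 2 ≡ suc p → M j ≡ false
    left-free j j+2≡ = before-pred-p mM' j (suc-injective (trans (+-comm 2 j) j+2≡))
    right-free : M (suc p + 2 * c + 2) ≡ false
    right-free = subst (λ i → M i ≡ false) (trans (cong suc q≡) (sym (end p c))) (before-suc-q mM')
      where
      end : ∀ p c → suc p + 2 * c + 2 ≡ suc (p + 2 * suc c)
      end = solve-∀
    iff : ∀ j → (M' j ≡ true) ⇔ ((M j ≡ true × ¬ InChain (suc p) c j) ⊎ InAug s (suc p) c j)
    iff j with outside-or-inside p q j
    ... | inj₁ o = mk⇔ (λ M'j → inj₁ (trans (sym (outside j o)) M'j , off-chain)) from
      where
      off-chain : ¬ InChain (suc p) c j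
      off-chain j∈C = Outside⇒¬Inside o (widen (proj₁ (InChain⇒odd-offset j∈C)))
      from : (M j ≡ true × ¬ InChain (suc p) c j) ⊎ InAug s (suc p) c j → M' j ≡ true
      from (inj₁ (Mj , _))   = trans (outside j o) Mj
      from (inj₂ (aug , _)) = ⊥-elim (Outside⇒¬Inside o (widen (proj₁ (augOffset⇒even-offset aug))))
    ... | inj₂ j∈ with odd (j ∸ p) in odd-j
    ...   | false = mk⇔ (λ _ → inj₂ (even-offset⇒augOffset (narrow j∈) odd-j ,
                                      Inside⇒InE 1≤p q≤s j∈))
                        (λ _ → trans (after-E j j∈) (cong not odd-j))
    ...   | true = mk⇔ (λ M'j → ⊥-elim (false≢true (trans (sym (cong not odd-j)) (trans (sym (after-E j j∈)) M'j)))) from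
      where
      from : (M j ≡ true × ¬ InChain (suc p) c j) ⊎ InAug s (suc p) c j → M' j ≡ true
      from (inj₁ (_ , off-chain)) = ⊥-elim (off-chain (odd-offset⇒InChain (narrow j∈) odd-j))
      from (inj₂ (aug , _))      = ⊥-elim (false≢true (trans (sym (proj₂ (augOffset⇒even-offset {p = p} aug))) odd-j))

  isAugmentation : IsAugmentation s M M'
  isAugmentation = mM' , FlipCount.card-suc flip 1≤p q≤s , shape
    where
    shape : (Σ ℕ λ i → Σ ℕ λ c → IsMaximalChain M i c ×
               (∀ j → (M' j ≡ true) ⇔ ((M j ≡ true × ¬ InChain i c j) ⊎ InAug s i c j)))
          ⊎ (Σ ℕ λ i → HasEmptyChain s M i × (∀ j → (M' j ≡ true) ⇔ (M j ≡ true ⊎ j ≡ i)))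
    shape with even-or-odd (q ∸ p)
    ... | inj₂ (k , w≡) = ⊥-elim (false≢true (trans (sym even-width) (trans (cong odd w≡) (odd-1+2* k))))
    ... | inj₁ (zero , w≡) = inj₂ (p , emptyChain (≤-antisym (m∸n≡0⇒m≤n w≡) p≤q))
    ... | inj₁ (suc c , w≡) = inj₁ (suc p , c , chain c (trans (sym (m+[n∸m]≡n p≤q)) (cong (p +_) w≡)))

module AugmentationFlip {s : ℕ} {M M' : EdgeSet} (mM : IsMatching s M) where
  open ChainOffsets

  emptyChain : ∀ i → HasEmptyChain s M i → (∀ j → (M' j ≡ true) ⇔ (M j ≡ true ⊎ j ≡ i)) →
               IntervalFlip s M M'
  emptyChain i ((1≤i , i≤s) , _ , Mi , _) iff = record { flip = F ; 1≤p = 1≤i ; q≤s = i≤s }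
    where
    at-i : ∀ {j} → Inside i i j → j ≡ i
    at-i (i≤j , j≤i) = ≤-antisym j≤i i≤j
    F : Flip s M M' i i
    F = record
      { p≤q        = ≤-refl
      ; even-width = cong odd (n∸n≡0 i)
      ; outside    = λ j o → ≡-from-true-⇔ (off-i o ∘ Equivalence.to (iff j)) (Equivalence.from (iff j) ∘ inj₁)
      ; before     = λ j j∈ → subst (λ k → M k ≡ odd (k ∸ i)) (sym (at-i j∈)) (trans Mi (cong odd (sym (n∸n≡0 i))))
      ; after      = λ j j∈ _ → subst (λ k → M' k ≡ not (odd (k ∸ i))) (sym (at-i j∈))
                                  (trans (Equivalence.from (iff i) (inj₂ refl)) (cong (not ∘ odd) (sym (n∸n≡0 i))))
      }
      where
      off-i : ∀ {j} → Outside i i j → M j ≡ true ⊎ j ≡ i → M j ≡ true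
      off-i o (inj₁ Mj)   = Mj
      off-i o (inj₂ refl) = ⊥-elim (Outside⇒¬Inside o (≤-refl , ≤-refl))

  chain : ∀ p c → IsMaximalChain M (suc p) c →
          (∀ j → (M' j ≡ true) ⇔ ((M j ≡ true × ¬ InChain (suc p) c j) ⊎ InAug s (suc p) c j)) →
          Flip s M M' p (p + 2 * suc c)
  chain p c (chain⊆M , _ , _) iff = record
    { p≤q        = m≤m+n p _
    ; even-width = trans (cong odd (m+n∸m≡n p _)) (odd-2* (suc c))
    ; outside    = outside
    ; before     = before
    ; after      = after
    }
    where
    outside : ∀ j → Outside p (p + 2 * suc c) j → M' j ≡ M j
    outside j o = ≡-from-true-⇔ (to ∘ Equivalence.to (iff j)) (λ Mj → Equivalence.from (iff j) (inj₁ (Mj , off-chain)))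
      where
      off-chain : ¬ InChain (suc p) c j
      off-chain j∈C = Outside⇒¬Inside o (proj₁ (InChain⇒odd-offset j∈C))
      to : (M j ≡ true × ¬ InChain (suc p) c j) ⊎ InAug s (suc p) c j → M j ≡ true
      to (inj₁ (Mj , _))  = Mj
      to (inj₂ (aug , _)) = ⊥-elim (Outside⇒¬Inside o (proj₁ (augOffset⇒even-offset {p = p} aug)))
    -- Edges at even offsets are not in M: offset 0 precedes the chain, offset 2k+2 follows its edge at 2k+1.
    before : ∀ j → Inside p (p + 2 * suc c) j → M j ≡ odd (j ∸ p)
    before j j∈ with offset-of-inside j∈ | even-or-odd (j ∸ p)
    ... | _ , _ | inj₂ (k , d≡) = trans (chain⊆M j (odd-offset⇒InChain j∈ odd-j)) (sym odd-j)
      where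
      odd-j : odd (j ∸ p) ≡ true
      odd-j = trans (cong odd d≡) (odd-1+2* k)
    ... | j≡ , d≤ | inj₁ (k , d≡) = trans (even-free k (trans j≡ (cong (p +_) d≡)) (subst (_≤ 2 * suc c) d≡ d≤))
                                          (sym (trans (cong odd d≡) (odd-2* k)))
      where
      next-but-one : ∀ p k → p + 2 * suc k ≡ suc (suc p + 2 * k)
      next-but-one = solve-∀
      even-free : ∀ k → j ≡ p + 2 * k → 2 * k ≤ 2 * suc c → M j ≡ false
      even-free zero    j≡p _ rewrite trans j≡p (+-identityʳ p) =
        IsMatching⇒prev-false mM (chain⊆M (suc p) (0 , z≤n , sym (+-identityʳ (suc p))))
      even-free (suc k) j≡ 2k+2≤ rewrite trans j≡ (next-but-one p k) =
        IsMatching⇒next-false mM (chain⊆M (suc p + 2 * k) (k , ≤-pred (*-cancelˡ-≤ 2 2k+2≤) , refl))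
    after : ∀ j → Inside p (p + 2 * suc c) j → InE s j → M' j ≡ not (odd (j ∸ p))
    after j j∈ j∈E with odd (j ∸ p) in odd-j
    ... | false = Equivalence.from (iff j) (inj₂ (even-offset⇒augOffset j∈ odd-j , j∈E))
    ... | true  = ≡-from-true-⇔ (λ M'j → ⊥-elim (not-in-M' (Equivalence.to (iff j) M'j))) λ ()
      where
      not-in-M' : ¬ ((M j ≡ true × ¬ InChain (suc p) c j) ⊎ InAug s (suc p) c j)
      not-in-M' (inj₁ (_ , off-chain)) = off-chain (odd-offset⇒InChain j∈ odd-j)
      not-in-M' (inj₂ (aug , _))      = false≢true (trans (sym (proj₂ (augOffset⇒even-offset {p = p} aug))) odd-j)

  isIntervalFlip : IsAugmentation s M M' → IntervalFlip s M M'
  isIntervalFlip (_ , _ , inj₂ (i , empty , iff)) = emptyChain i empty iff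
  isIntervalFlip (_ , _ , inj₁ (zero , c , (chain⊆M , _) , _)) =
    ⊥-elim (n≮n 0 (proj₁ (proj₁ mM 0 (chain⊆M 0 (0 , z≤n , refl)))))
  isIntervalFlip (_ , card-M' , inj₁ (suc p , c , maximal , iff)) =
    record { flip = F ; 1≤p = proj₁ bounds ; q≤s = proj₂ bounds }
    where
    F : Flip s M M' p (p + 2 * suc c)
    F = chain p c maximal iff
    bounds : 1 ≤ p × p + 2 * suc c ≤ s
    bounds = FlipCount.card-suc⇒bounds F (proj₁ mM) card-M'

sumTo-exchange : ∀ (f g h k : ℕ → ℕ) n → (∀ j → f j + g j ≡ h j + k j) →
                 sumTo f n + sumTo g n ≡ sumTo h n + sumTo k n
sumTo-exchange f g h k zero    _  = refl
sumTo-exchange f g h k (suc n) eq = begin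
  sumTo f n + f (suc n) + (sumTo g n + g (suc n)) ≡⟨ interchange (sumTo f n) (f (suc n)) (sumTo g n) (g (suc n)) ⟩
  sumTo f n + sumTo g n + (f (suc n) + g (suc n)) ≡⟨ cong₂ _+_ (sumTo-exchange f g h k n eq) (eq (suc n)) ⟩
  sumTo h n + sumTo k n + (h (suc n) + k (suc n)) ≡⟨ interchange (sumTo h n) (sumTo k n) (h (suc n)) (k (suc n)) ⟩
  sumTo h n + h (suc n) + (sumTo k n + k (suc n)) ∎
  where
  open ≡-Reasoning
  interchange : ∀ a b c d → a + b + (c + d) ≡ a + c + (b + d)
  interchange = solve-∀

Recombines : EdgeSet → EdgeSet → EdgeSet → EdgeSet → Set
Recombines C A X Y = ∀ j → (C j ≡ X j × A j ≡ Y j) ⊎ (C j ≡ Y j × A j ≡ X j)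

wt-recombine : ∀ s w {C A X Y} → Recombines C A X Y → wt s w C + wt s w A ≡ wt s w X + wt s w Y
wt-recombine s w {C} {A} {X} {Y} rec = sumTo-exchange _ _ _ _ s pointwise
  where
  weight : EdgeSet → ℕ → ℕ
  weight N j = if N j then w j else 0
  pointwise : ∀ j → weight C j + weight A j ≡ weight X j + weight Y j
  pointwise j with rec j
  ... | inj₁ (Cj , Aj) rewrite Cj | Aj = refl
  ... | inj₂ (Cj , Aj) rewrite Cj | Aj = +-comm (weight Y j) (weight X j)

patch : ℕ → ℕ → EdgeSet → EdgeSet → EdgeSet
patch a b N O j with outside-or-inside a b j
... | inj₁ _ = O j
... | inj₂ _ = N j

patch-inside : ∀ {a b N O j} → Inside a b j → patch a b N O j ≡ N j
patch-inside {a} {b} {j = j} j∈ with outside-or-inside a b j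
... | inj₁ o = ⊥-elim (Outside⇒¬Inside o j∈)
... | inj₂ _ = refl

patch-outside : ∀ {a b N O j} → Outside a b j → patch a b N O j ≡ O j
patch-outside {a} {b} {j = j} o with outside-or-inside a b j
... | inj₁ _  = refl
... | inj₂ j∈ = ⊥-elim (Outside⇒¬Inside o j∈)

patch-augmentation : ∀ {s A N a b} → IsMatching s A → 1 ≤ a → b ≤ s → a ≤ b → odd (b ∸ a) ≡ false →
                     (∀ j → Inside a b j → A j ≡ odd (j ∸ a) × N j ≡ not (odd (j ∸ a))) →
                     (∀ j → suc j ≡ a → A j ≡ false) → A (suc b) ≡ false → IsAugmentation s A (patch a b N A)
patch-augmentation {s} {A} {N} {a} {b} mA 1≤a b≤s a≤b even-width alternating left-free right-free =
  FlipAugmentation.isAugmentation (IntervalFlip.isMatching F mA left-free right-free) F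
  where
  F : IntervalFlip s A (patch a b N A)
  F = record
    { flip = record
      { p≤q        = a≤b
      ; even-width = even-width
      ; outside    = λ j o → patch-outside o
      ; before     = λ j j∈ → proj₁ (alternating j j∈)
      ; after      = λ j j∈ _ → trans (patch-inside j∈) (proj₂ (alternating j j∈))
      }
    ; 1≤p = 1≤a
    ; q≤s = b≤s
    }

module Exchange {s : ℕ} (w : ℕ → ℕ) {A B C : EdgeSet} (mA : IsMatching s A) (mC : IsMatching s C)
                (B-aug : IsAugmentation s A B) (B-minimal : ∀ X → IsAugmentation s A X → wt s w B ≤ wt s w X)
                (F₁ : IntervalFlip s A B) (F₂ : IntervalFlip s B C) where
  module F₁ = IntervalFlip F₁
  module F₂ = IntervalFlip F₂
  open F₁ using () renaming (p to p₁; q to q₁)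
  open F₂ using () renaming (p to p₂; q to q₂)

  via-recombination : ∀ {X Y} → IsAugmentation s A X → IsAugmentation s A Y → Recombines C A X Y →
                      wt s w B + wt s w B ≤ wt s w C + wt s w A
  via-recombination X-aug Y-aug rec =
    subst (wt s w B + wt s w B ≤_) (sym (wt-recombine s w rec)) (+-mono-≤ (B-minimal _ X-aug) (B-minimal _ Y-aug))

  augment-in-I₂ : ∀ {a b} → p₂ ≤ a → a ≤ b → b ≤ q₂ → odd (a ∸ p₂) ≡ false → odd (b ∸ a) ≡ false →
                  (∀ j → Inside a b j → Outside p₁ q₁ j) →
                  (∀ j → suc j ≡ a → A j ≡ false) → A (suc b) ≡ false → IsAugmentation s A (patch a b C A)
  augment-in-I₂ {a} {b} p₂≤a a≤b b≤q₂ even-a even-width off-I₁ =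
    patch-augmentation mA (≤-trans F₂.1≤p p₂≤a) (≤-trans b≤q₂ F₂.q≤s) a≤b even-width alternating
    where
    alternating : ∀ j → Inside a b j → A j ≡ odd (j ∸ a) × C j ≡ not (odd (j ∸ a))
    alternating j (a≤j , j≤b) with F₂.pattern-from p₂≤a even-a a≤j (≤-trans j≤b b≤q₂)
    ... | Bj , Cj = trans (sym (F₁.outside j (off-I₁ j (a≤j , j≤b)))) Bj , Cj

  disjoint : (∀ j → Inside p₂ q₂ j → Outside p₁ q₁ j) → wt s w B + wt s w B ≤ wt s w C + wt s w A
  disjoint off-I₁ = via-recombination B-aug Y-aug rec
    where
    left-free : ∀ j → suc j ≡ p₂ → A j ≡ false
    left-free j 1+j≡p₂ with outside-or-inside p₁ q₁ j | off-I₁ p₂ (≤-refl , F₂.p≤q)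
    ... | inj₁ o | _ = trans (sym (F₁.outside j o)) (F₂.before-pred-p mC j 1+j≡p₂)
    ... | inj₂ (p₁≤j , _) | inj₁ p₂<p₁ = ⊥-elim (<-asym p₂<p₁ (subst (p₁ <_) 1+j≡p₂ (s≤s p₁≤j)))
    ... | inj₂ (_ , j≤q₁) | inj₂ q₁<p₂ =
      subst (λ i → A i ≡ false) (≤-antisym (≤-pred (subst (q₁ <_) (sym 1+j≡p₂) q₁<p₂)) j≤q₁) F₁.before-q
    right-free : A (suc q₂) ≡ false
    right-free with outside-or-inside p₁ q₁ (suc q₂) | off-I₁ q₂ (F₂.p≤q , ≤-refl)
    ... | inj₁ o | _ = trans (sym (F₁.outside (suc q₂) o)) (F₂.before-suc-q mC)
    ... | inj₂ (p₁≤1+q₂ , _) | inj₁ q₂<p₁ = subst (λ i → A i ≡ false) (sym (≤-antisym q₂<p₁ p₁≤1+q₂)) F₁.before-p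
    ... | inj₂ (_ , 1+q₂≤q₁) | inj₂ q₁<q₂ = ⊥-elim (<-asym q₁<q₂ 1+q₂≤q₁)
    Y-aug : IsAugmentation s A (patch p₂ q₂ C A)
    Y-aug = augment-in-I₂ ≤-refl F₂.p≤q ≤-refl (cong odd (n∸n≡0 p₂)) F₂.even-width off-I₁ left-free right-free
    rec : Recombines C A B (patch p₂ q₂ C A)
    rec j = [ (λ o → inj₁ (F₂.outside j o , sym (patch-outside o)))
            , (λ j∈ → inj₂ (sym (patch-inside j∈) , sym (F₁.outside j (off-I₁ j j∈))))
            ]′ (outside-or-inside p₂ q₂ j)

  C≡A-on-I₁ : ∀ {j} → Inside p₂ q₂ j → Inside p₁ q₁ j → C j ≡ A j
  C≡A-on-I₁ {j} j∈I₂ j∈I₁ = begin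
    C j                      ≡⟨ F₂.after-E j j∈I₂ ⟩
    not (odd (j ∸ p₂))       ≡⟨ cong not (sym (F₂.before j j∈I₂)) ⟩
    not (B j)                ≡⟨ cong not (F₁.after-E j j∈I₁) ⟩
    not (not (odd (j ∸ p₁))) ≡⟨ not-involutive _ ⟩
    odd (j ∸ p₁)             ≡⟨ sym (F₁.before j j∈I₁) ⟩
    A j                      ∎
    where open ≡-Reasoning

  -- C is A with the two alternating segments [p₂, p₁ − 1] and [q₁ + 1, q₂] augmented.
  module Nested (p₂<p₁ : p₂ < p₁) (q₁<q₂ : q₁ < q₂) where
    b : ℕ
    b = p₁ ∸ 1
    1+b≡p₁ : suc b ≡ p₁
    1+b≡p₁ = m+[n∸m]≡n F₁.1≤p
    p₂≤b : p₂ ≤ b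
    p₂≤b = ≤-pred (subst (p₂ <_) (sym 1+b≡p₁) p₂<p₁)
    p₂≤q₁ : p₂ ≤ q₁
    p₂≤q₁ = ≤-trans (<⇒≤ p₂<p₁) F₁.p≤q
    p₁≤q₂ : p₁ ≤ q₂
    p₁≤q₂ = ≤-trans F₁.p≤q (<⇒≤ q₁<q₂)
    odd-p₁ : odd (suc b ∸ p₂) ≡ true
    odd-p₁ = trans (cong (λ i → odd (i ∸ p₂)) 1+b≡p₁)
                   (trans (sym (F₂.before p₁ (<⇒≤ p₂<p₁ , p₁≤q₂))) F₁.after-p)
    even-1+q₁ : odd (suc q₁ ∸ p₂) ≡ false
    even-1+q₁ = trans (odd-suc-∸ p₂≤q₁)
                      (cong not (trans (sym (F₂.before q₁ (p₂≤q₁ , <⇒≤ q₁<q₂))) F₁.after-q))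
    X Y : EdgeSet
    X = patch p₂ b C A
    Y = patch (suc q₁) q₂ C A
    X-inside : ∀ {j} → Inside p₂ b j → X j ≡ C j
    X-inside = patch-inside
    X-outside : ∀ {j} → Outside p₂ b j → X j ≡ A j
    X-outside = patch-outside
    Y-inside : ∀ {j} → Inside (suc q₁) q₂ j → Y j ≡ C j
    Y-inside = patch-inside
    Y-outside : ∀ {j} → Outside (suc q₁) q₂ j → Y j ≡ A j
    Y-outside = patch-outside
    X-aug : IsAugmentation s A X
    X-aug = augment-in-I₂ ≤-refl p₂≤b (≤-trans (n≤1+n b) (subst (_≤ q₂) (sym 1+b≡p₁) p₁≤q₂))
      (cong odd (n∸n≡0 p₂)) (not-injective (trans (sym (odd-suc-∸ p₂≤b)) odd-p₁))
      (λ j (_ , j≤b) → inj₁ (subst (j <_) 1+b≡p₁ (s≤s j≤b)))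
      (λ j 1+j≡p₂ → trans (sym (F₁.outside j (inj₁ (<-trans (subst (j <_) 1+j≡p₂ ≤-refl) p₂<p₁))))
                          (F₂.before-pred-p mC j 1+j≡p₂))
      (subst (λ i → A i ≡ false) (sym 1+b≡p₁) F₁.before-p)
    Y-aug : IsAugmentation s A Y
    Y-aug = augment-in-I₂ (≤-trans p₂≤q₁ (n≤1+n q₁)) q₁<q₂ ≤-refl even-1+q₁
      (trans (sym (odd-∸-rebase (≤-trans p₂≤q₁ (n≤1+n q₁)) q₁<q₂ even-1+q₁)) F₂.even-width)
      (λ j (1+q₁≤j , _) → inj₂ 1+q₁≤j)
      (λ j 1+j≡1+q₁ → subst (λ i → A i ≡ false) (sym (suc-injective 1+j≡1+q₁)) F₁.before-q)
      (trans (sym (F₁.outside (suc q₂) (inj₂ (m<n⇒m<1+n q₁<q₂)))) (F₂.before-suc-q mC))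
    inside-I₂ : ∀ j → Inside p₂ q₂ j → (C j ≡ X j × A j ≡ Y j) ⊎ (C j ≡ Y j × A j ≡ X j)
    inside-I₂ j j∈I₂@(p₂≤j , j≤q₂) with outside-or-inside p₁ q₁ j
    ... | inj₁ (inj₁ j<p₁) =
      inj₁ (sym (X-inside (p₂≤j , ≤-pred (subst (j <_) (sym 1+b≡p₁) j<p₁))) ,
            sym (Y-outside (inj₁ (<-≤-trans j<p₁ (≤-trans F₁.p≤q (n≤1+n q₁))))))
    ... | inj₁ (inj₂ q₁<j) =
      inj₂ (sym (Y-inside (q₁<j , j≤q₂)) ,
            sym (X-outside (inj₂ (subst (_≤ j) (sym 1+b≡p₁) (≤-trans F₁.p≤q (<⇒≤ q₁<j))))))
    ... | inj₂ j∈I₁@(p₁≤j , j≤q₁) =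
      inj₁ (trans (C≡A-on-I₁ j∈I₂ j∈I₁) (sym (X-outside (inj₂ (subst (_≤ j) (sym 1+b≡p₁) p₁≤j)))) ,
            sym (Y-outside (inj₁ (s≤s j≤q₁))))
    rec : Recombines C A X Y
    rec j = [ (λ o → inj₁ (trans (F₂.outside j o) (trans (F₁.outside j (off-I₁ o)) (sym (X-outside (off-X o)))) ,
                          sym (Y-outside (off-Y o))))
            , inside-I₂ j
            ]′ (outside-or-inside p₂ q₂ j)
      where
      off-I₁ : Outside p₂ q₂ j → Outside p₁ q₁ j
      off-I₁ (inj₁ j<p₂) = inj₁ (<-trans j<p₂ p₂<p₁)
      off-I₁ (inj₂ q₂<j) = inj₂ (<-trans q₁<q₂ q₂<j)
      off-X : Outside p₂ q₂ j → Outside p₂ b j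
      off-X (inj₁ j<p₂) = inj₁ j<p₂
      off-X (inj₂ q₂<j) = inj₂ (<-trans (subst (_≤ q₂) (sym 1+b≡p₁) p₁≤q₂) q₂<j)
      off-Y : Outside p₂ q₂ j → Outside (suc q₁) q₂ j
      off-Y (inj₁ j<p₂) = inj₁ (<-trans j<p₂ (s≤s p₂≤q₁))
      off-Y (inj₂ q₂<j) = inj₂ q₂<j

  nested : p₂ < p₁ → q₁ < q₂ → wt s w B + wt s w B ≤ wt s w C + wt s w A
  nested p₂<p₁ q₁<q₂ = via-recombination X-aug Y-aug rec
    where open Nested p₂<p₁ q₁<q₂

  -- Inside I₁ the edges missing from B are isolated, whereas at either end of I₂
  -- two consecutive edges are missing from B.
  ¬overlap-left : p₁ ≤ p₂ → p₂ ≤ q₁ → ⊥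
  ¬overlap-left p₁≤p₂ p₂≤q₁ =
    false≢true (trans (sym (F₂.before-pred-p mC a 1+a≡p₂))
      (proj₂ (F₁.after-false⇒prev-true (subst (Inside p₁ q₁) (sym 1+a≡p₂) (p₁≤p₂ , p₂≤q₁))
                                        (subst (λ i → B i ≡ false) (sym 1+a≡p₂) F₂.before-p))))
    where
    a : ℕ
    a = p₂ ∸ 1
    1+a≡p₂ : suc a ≡ p₂
    1+a≡p₂ = m+[n∸m]≡n F₂.1≤p

  ¬overlap-right : p₁ ≤ q₂ → q₂ ≤ q₁ → ⊥
  ¬overlap-right p₁≤q₂ q₂≤q₁ =
    false≢true (trans (sym (F₂.before-suc-q mC)) (proj₂ (F₁.after-false⇒next-true (p₁≤q₂ , q₂≤q₁) F₂.before-q)))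

  midpoint : wt s w B + wt s w B ≤ wt s w C + wt s w A
  midpoint with q₁ <? p₂ | q₂ <? p₁
  ... | yes q₁<p₂ | _ = disjoint λ j (p₂≤j , _) → inj₂ (<-≤-trans q₁<p₂ p₂≤j)
  ... | no _ | yes q₂<p₁ = disjoint λ j (_ , j≤q₂) → inj₁ (≤-<-trans j≤q₂ q₂<p₁)
  ... | no q₁≮p₂ | no q₂≮p₁ with p₂ <? p₁ | q₁ <? q₂
  ...   | yes p₂<p₁ | yes q₁<q₂ = nested p₂<p₁ q₁<q₂
  ...   | no p₂≮p₁  | _         = ⊥-elim (¬overlap-left (≮⇒≥ p₂≮p₁) (≮⇒≥ q₁≮p₂))
  ...   | _         | no q₁≮q₂  = ⊥-elim (¬overlap-right (≮⇒≥ q₂≮p₁) (≮⇒≥ q₁≮q₂))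

midpoint⇒differences-≤ : ∀ a b c → b + b ≤ c + a → (ℤ.+ b) ℤ.- (ℤ.+ a) ≤ℤ (ℤ.+ c) ℤ.- (ℤ.+ b)
midpoint⇒differences-≤ a b c b+b≤c+a =
  subst₂ _≤ℤ_ (left (ℤ.+ a) (ℤ.+ b)) (right (ℤ.+ a) (ℤ.+ b) (ℤ.+ c))
               (ℤₚ.+-monoˡ-≤ (ℤ.- ((ℤ.+ a) ℤ.+ (ℤ.+ b))) (+≤+ b+b≤c+a))
  where
  left : ∀ (a b : ℤ) → (b ℤ.+ b) ℤ.+ ℤ.- (a ℤ.+ b) ≡ b ℤ.- a
  left = ℤ-Solver.solve-∀
  right : ∀ (a b c : ℤ) → (c ℤ.+ a) ℤ.+ ℤ.- (a ℤ.+ b) ≡ c ℤ.- b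
  right = ℤ-Solver.solve-∀

run-isMatching : ∀ {s w Ms r} → IsHungarianRun s w Ms r → ∀ k → k ≤ r → IsMatching s (Ms k)
run-isMatching (empty , _) zero _ =
  (λ j M₀j → ⊥-elim (false≢true (trans (sym (empty j)) M₀j))) ,
  (λ i (M₀i , _) → false≢true (trans (sym (empty i)) M₀i))
run-isMatching (_ , step) (suc k) 1+k≤r with step (suc k) (s≤s z≤n) 1+k≤r
... | _ , refl , augmentation , _ = proj₁ augmentation

lemma8 : (s : ℕ) (w : ℕ → ℕ) → (∀ j → 1 ≤ j → j ≤ s → 0 < w j) → (Ms : ℕ → EdgeSet) → (r : ℕ) → r ≤ ⌈ s /2⌉ → IsHungarianRun s w Ms r →
    ∀ i → 1 ≤ i → i < r → Δ s w Ms i ≤ℤ Δ s w Ms (suc i)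
lemma8 s w _ Ms r _ run (suc i) _ 2+i≤r
  with proj₂ run (suc i) (s≤s z≤n) (<⇒≤ 2+i≤r) | proj₂ run (suc (suc i)) (s≤s z≤n) 2+i≤r
... | _ , refl , M→M′ , M′-minimal | _ , refl , M′→M″ , _ =
  midpoint⇒differences-≤ (wt s w (Ms i)) _ _ (Exchange.midpoint w mM (proj₁ M′→M″) M→M′ M′-minimal
                            (AugmentationFlip.isIntervalFlip mM M→M′)
                            (AugmentationFlip.isIntervalFlip (proj₁ M→M′) M′→M″))
  where
  mM : IsMatching s (Ms i)
  mM = run-isMatching run i (≤-trans (n≤1+n i) (<⇒≤ 2+i≤r))
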